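{- For every $n\ge 3$ and every $k\ge0$, \[ d_{n,k} = \sum_{j=0}^k\left(\binom{n-2j}{k-j}\binom{j}{n-k-j} +\binom{n-2j-1}{k-j}\binom{j}{n-k-j-1} -\binom{n-2j-2}{k-j-2}\binom{j}{n-k-j}\right). \]
   Context: For $n\ge 0$, the $S$-fence $\phi_n$ is the poset on $\{x_1,\dots,x_n\}$ whose order is generated by the cover relations $x_2<x_1$, $x_3<x_2$, $x_2<x_4$, $x_5<x_4$, and, for every $i\ge 3$, $x_{2i-1}<x_{2i}$ and $x_{2i+1}<x_{2i}$, keeping only those relations whose elements both have index $\le n$. A filter is an up-set. $\Phi_n$ is the underlying undirected graph of the Hasse diagram of the lattice of filters of $\phi_n$ ordered by reverse inclusion (two filters adjacent iff they differ in exactly one element). $d_{n,k}$ is the number of vertices of $\Phi_n$ of degree $k$. Convention: $\binom{a}{b}=0$ unless $0\le b\le a$. -}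

module Defs where

open import Data.Bool using (Bool; true; false)
open import Data.Nat as ℕ using (ℕ; zero; suc; _+_; _*_; _∸_; _≤_; _<_; _≤?_; z≤n; s≤s)
open import Data.Nat.Properties as ℕP using ()
open import Data.Nat.Combinatorics using (_C_)
open import Data.Integer as ℤ using (ℤ; +_; -[1+_])
open import Data.Fin using (Fin; toℕ; fromℕ<)
open import Data.Fin.Properties using (any?; all?; toℕ<n; toℕ-fromℕ<)
open import Data.Fin.Subset using (Subset; _∈_)
open import Data.Fin.Subset.Properties using (_∈?_)
open import Data.Vec using (Vec; []; _∷_)
open import Data.List using (List; []; _∷_; map; _++_; filter; length)
open import Data.Product using (Σ; ∃; _×_; _,_; proj₁; proj₂)
open import Data.Sum using (_⊎_; inj₁; inj₂)
open import Relation.Nullary using (Dec; yes; no; ¬_)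
open import Relation.Nullary.Decidable using (_×-dec_; _⊎-dec_; map′; _→-dec_)
open import Relation.Binary.PropositionalEquality using (_≡_; refl; sym; subst; subst₂)
open import Relation.Binary.Construct.Closure.ReflexiveTransitive using (Star; ε; _◅_)

-- Elements x_1, …, x_n; we use the paper's 1-based indices for the
-- generating cover relations.  `Cov a b` means "x_a < x_b" is one of the
-- generating cover relations:
--   x_2 < x_1, x_3 < x_2, x_2 < x_4, x_5 < x_4, and for every i ≥ 3,
--   x_{2i-1} < x_{2i} and x_{2i+1} < x_{2i}.

data Cov : ℕ → ℕ → Set where
  c21   : Cov 2 1
  c32   : Cov 3 2
  c24   : Cov 2 4
  c54   : Cov 5 4
  cup   : ∀ i → 3 ≤ i → Cov (2 * i ∸ 1) (2 * i)
  cdown : ∀ i → 3 ≤ i → Cov (2 * i + 1) (2 * i)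

-- The element x_{a+1} of φ_n is represented by a : Fin n (0-based), so the
-- restriction "both indices ≤ n" is automatic.
_⋖_ : ∀ {n} → Fin n → Fin n → Set
x ⋖ y = Cov (suc (toℕ x)) (suc (toℕ y))

_≤φ_ : ∀ {n} → Fin n → Fin n → Set
_≤φ_ = Star _⋖_

IsFilter : ∀ {n} → Subset n → Set
IsFilter {n} S = ∀ {x y : Fin n} → x ≤φ y → x ∈ S → y ∈ S

private
  data CovView (a b : ℕ) : Set where
    v21 : a ≡ 2 → b ≡ 1 → CovView a b
    v32 : a ≡ 3 → b ≡ 2 → CovView a b
    v24 : a ≡ 2 → b ≡ 4 → CovView a b
    v54 : a ≡ 5 → b ≡ 4 → CovView a b
    vup : (i : Fin (suc b)) → 3 ≤ toℕ i → a ≡ 2 * toℕ i ∸ 1 → b ≡ 2 * toℕ i → CovView a b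
    vdn : (i : Fin (suc b)) → 3 ≤ toℕ i → a ≡ 2 * toℕ i + 1 → b ≡ 2 * toℕ i → CovView a b

  fromView : ∀ {a b} → CovView a b → Cov a b
  fromView (v21 refl refl) = c21
  fromView (v32 refl refl) = c32
  fromView (v24 refl refl) = c24
  fromView (v54 refl refl) = c54
  fromView (vup i h p q) = subst₂ Cov (sym p) (sym q) (cup (toℕ i) h)
  fromView (vdn i h p q) = subst₂ Cov (sym p) (sym q) (cdown (toℕ i) h)

  i≤2i : ∀ i → i < suc (2 * i)
  i≤2i i = s≤s (ℕP.m≤m+n i (i + 0))

  toView : ∀ {a b} → Cov a b → CovView a b
  toView c21 = v21 refl refl
  toView c32 = v32 refl refl
  toView c24 = v24 refl refl
  toView c54 = v54 refl refl
  toView (cup i h) = vup (fromℕ< (i≤2i i)) (subst (3 ≤_) (sym (toℕ-fromℕ< (i≤2i i))) h)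
    (subst (λ k → 2 * i ∸ 1 ≡ 2 * k ∸ 1) (sym (toℕ-fromℕ< (i≤2i i))) refl)
    (subst (λ k → 2 * i ≡ 2 * k) (sym (toℕ-fromℕ< (i≤2i i))) refl)
  toView (cdown i h) = vdn (fromℕ< (i≤2i i)) (subst (3 ≤_) (sym (toℕ-fromℕ< (i≤2i i))) h)
    (subst (λ k → 2 * i + 1 ≡ 2 * k + 1) (sym (toℕ-fromℕ< (i≤2i i))) refl)
    (subst (λ k → 2 * i ≡ 2 * k) (sym (toℕ-fromℕ< (i≤2i i))) refl)

  _≟_ = ℕP._≟_

  view? : ∀ a b → Dec (CovView a b)
  view? a b = map′ to from
    (  ((a ≟ 2) ×-dec (b ≟ 1))
    ⊎-dec ((a ≟ 3) ×-dec (b ≟ 2))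
    ⊎-dec ((a ≟ 2) ×-dec (b ≟ 4))
    ⊎-dec ((a ≟ 5) ×-dec (b ≟ 4))
    ⊎-dec any? (λ i → (3 ≤? toℕ i) ×-dec (a ≟ (2 * toℕ i ∸ 1)) ×-dec (b ≟ (2 * toℕ i)))
    ⊎-dec any? (λ i → (3 ≤? toℕ i) ×-dec (a ≟ (2 * toℕ i + 1)) ×-dec (b ≟ (2 * toℕ i))))
    where
    to : _ → CovView a b
    to (inj₁ (p , q)) = v21 p q
    to (inj₂ (inj₁ (p , q))) = v32 p q
    to (inj₂ (inj₂ (inj₁ (p , q)))) = v24 p q
    to (inj₂ (inj₂ (inj₂ (inj₁ (p , q))))) = v54 p q
    to (inj₂ (inj₂ (inj₂ (inj₂ (inj₁ (i , h , p , q)))))) = vup i h p q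
    to (inj₂ (inj₂ (inj₂ (inj₂ (inj₂ (i , h , p , q)))))) = vdn i h p q
    from : CovView a b → _
    from (v21 p q) = inj₁ (p , q)
    from (v32 p q) = inj₂ (inj₁ (p , q))
    from (v24 p q) = inj₂ (inj₂ (inj₁ (p , q)))
    from (v54 p q) = inj₂ (inj₂ (inj₂ (inj₁ (p , q))))
    from (vup i h p q) = inj₂ (inj₂ (inj₂ (inj₂ (inj₁ (i , h , p , q)))))
    from (vdn i h p q) = inj₂ (inj₂ (inj₂ (inj₂ (inj₂ (i , h , p , q)))))

Cov? : ∀ a b → Dec (Cov a b)
Cov? a b = map′ fromView toView (view? a b)

private
  CoverClosed : ∀ {n} → Subset n → Set
  CoverClosed {n} S = ∀ (x y : Fin n) → x ⋖ y → x ∈ S → y ∈ S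

  cc? : ∀ {n} (S : Subset n) → Dec (CoverClosed S)
  cc? S = all? (λ x → all? (λ y → Cov? _ _ →-dec ((x ∈? S) →-dec (y ∈? S))))

  cc→f : ∀ {n} {S : Subset n} → CoverClosed S → IsFilter S
  cc→f c ε x∈ = x∈
  cc→f c (r ◅ rs) x∈ = cc→f c rs (c _ _ r x∈)

IsFilter? : ∀ {n} (S : Subset n) → Dec (IsFilter S)
IsFilter? S = map′ cc→f (λ f x y r → f (r ◅ ε)) (cc? S)

subsets : ∀ n → List (Subset n)
subsets zero = [] ∷ []
subsets (suc n) = map (true ∷_) (subsets n) ++ map (false ∷_) (subsets n)

-- Vertices of Φ_n: the filters of φ_n (each listed exactly once).
filters : ∀ n → List (Subset n)
filters n = filter IsFilter? (subsets n)

hamming : ∀ {n} → Subset n → Subset n → ℕ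
hamming [] [] = 0
hamming (true ∷ s) (true ∷ t) = hamming s t
hamming (false ∷ s) (false ∷ t) = hamming s t
hamming (true ∷ s) (false ∷ t) = suc (hamming s t)
hamming (false ∷ s) (true ∷ t) = suc (hamming s t)

-- Two filters are adjacent in Φ_n iff they differ in exactly one element.
Adjacent : ∀ {n} → Subset n → Subset n → Set
Adjacent S T = hamming S T ≡ 1

degree : ∀ n → Subset n → ℕ
degree n S = length (filter (λ T → hamming S T ≟ 1) (filters n))

d : ℕ → ℕ → ℕ
d n k = length (filter (λ S → degree n S ≟ k) (filters n))

-- Binomial coefficient with integer arguments:
-- binom a b = (a choose b) if 0 ≤ b ≤ a, and 0 otherwise.

binom : ℤ → ℤ → ℤ
binom (+ a) (+ b) with b ≤? a
... | yes _ = + (a C b)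
... | no _  = + 0
binom (+ a) -[1+ b ] = + 0
binom -[1+ a ] b = + 0

sumTo : ℕ → (ℕ → ℤ) → ℤ
sumTo zero f = f 0
sumTo (suc k) f = sumTo k f ℤ.+ f (suc k)

rhs : ℕ → ℕ → ℤ
rhs n k = sumTo k λ j →
  let N = + n ; K = + k ; J = + j ; two = + 2 in
      binom (N ℤ.- two ℤ.* J) (K ℤ.- J) ℤ.* binom J (N ℤ.- K ℤ.- J)
  ℤ.+ binom (N ℤ.- two ℤ.* J ℤ.- + 1) (K ℤ.- J) ℤ.* binom J (N ℤ.- K ℤ.- J ℤ.- + 1)
  ℤ.- binom (N ℤ.- two ℤ.* J ℤ.- two) (K ℤ.- J ℤ.- two) ℤ.* binom J (N ℤ.- K ℤ.- J)

-- Both sides satisfy a(n+3, k) = a(n+2, k-1) + a(n+1, k-1) + a(n, k-1) - a(n, k-2) for n ≥ 5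
-- and agree for n = 3, ..., 7 by evaluation.
--
-- From the fifth element on, the only cover relation between x_{n+1} and earlier elements is
-- the one with x_n, upwards or downwards according to the parity of n. Hence a filter grows one
-- bit at a time, and appending c to a filter S a b raises its degree in Φ by an amount depending
-- only on a, b, c and the parity. Counting filters by degree and by their last two bits thus
-- gives a four-state transfer on generating functions, and the recurrence is read off from
-- three consecutive transfer steps.
--
-- For the binomial sum, Pascal's rule, which on all of ℤ² fails only at the origin, splits
-- the alternating combination of four shifted sums into one further shifted sum plus a
-- telescoping sum whose only surviving boundary term is a Kronecker delta at the origin;
-- for n ≥ 3 these deltas vanish.

module Submission where

open import Defs

module BinomialSums where

  open import Data.Nat as ℕ using (ℕ; zero; suc)
  import Data.Nat.Properties as ℕP
  open import Data.Nat.Combinatorics using (_C_; nCk+nC[k+1]≡[n+1]C[k+1]; k>n⇒nCk≡0)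
  open import Data.Integer using (ℤ; +_; -[1+_]; _+_; _-_; _*_; -_; _≤_; +≤+)
  import Data.Integer.Properties as ℤP
  open import Data.Integer.Tactic.RingSolver using (solve-∀)
  open import Data.Sum using (inj₁; inj₂)
  open import Relation.Nullary using (yes; no)
  open import Relation.Binary.PropositionalEquality hiding (J)

  binom-+ : ∀ a b → binom (+ a) (+ b) ≡ + (a C b)
  binom-+ a b with b ℕ.≤? a
  ... | yes _ = refl
  ... | no b≰a = cong +_ (sym (k>n⇒nCk≡0 (ℕP.≰⇒> b≰a)))

  binom-negʳ : ∀ m r → binom m -[1+ r ] ≡ + 0
  binom-negʳ (+ _) _ = refl
  binom-negʳ -[1+ _ ] _ = refl

  -≡-[1+∸] : ∀ {k j} → k ℕ.< j → + k - + j ≡ -[1+ j ℕ.∸ suc k ]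
  -≡-[1+∸] {k} {suc j} (ℕ.s≤s k≤j) = trans (ℤP.⊖-< (ℕ.s≤s k≤j)) (cong (λ t → - (+ t)) (ℕP.+-∸-assoc 1 k≤j))

  binom-<ʳ : ∀ m {k j} → k ℕ.< j → binom m (+ k - + j) ≡ + 0
  binom-<ʳ m k<j = trans (cong (binom m) (-≡-[1+∸] k<j)) (binom-negʳ m _)

  binom-pred-self : ∀ m → binom (m - + 1) m ≡ + 0
  binom-pred-self (+ zero) = refl
  binom-pred-self (+ suc a) = trans (binom-+ a (suc a)) (cong +_ (k>n⇒nCk≡0 (ℕP.n<1+n a)))
  binom-pred-self -[1+ _ ] = refl

  δ₀ : ℤ → ℤ → ℤ
  δ₀ (+ zero) (+ zero) = + 1
  δ₀ (+ zero) (+ suc _) = + 0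
  δ₀ (+ zero) -[1+ _ ] = + 0
  δ₀ (+ suc _) _ = + 0
  δ₀ -[1+ _ ] _ = + 0

  δ₀-negʳ : ∀ m r → δ₀ m -[1+ r ] ≡ + 0
  δ₀-negʳ (+ zero) _ = refl
  δ₀-negʳ (+ suc _) _ = refl
  δ₀-negʳ -[1+ _ ] _ = refl

  δ₀-*-cong : ∀ m r {a b} → (m ≡ + 0 → r ≡ + 0 → a ≡ b) → δ₀ m r * a ≡ δ₀ m r * b
  δ₀-*-cong (+ zero) (+ zero) a≡b = cong (+ 1 *_) (a≡b refl refl)
  δ₀-*-cong (+ zero) (+ suc _) _ = refl
  δ₀-*-cong (+ zero) -[1+ _ ] _ = refl
  δ₀-*-cong (+ suc _) _ _ = refl
  δ₀-*-cong -[1+ _ ] _ _ = refl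

  binom-pascal : ∀ m r → binom m r ≡ binom (m - + 1) r + binom (m - + 1) (r - + 1) + δ₀ m r
  binom-pascal -[1+ _ ] r = refl
  binom-pascal (+ zero) (+ zero) = refl
  binom-pascal (+ zero) (+ suc _) = refl
  binom-pascal (+ zero) -[1+ _ ] = refl
  binom-pascal (+ suc a) -[1+ r ] = sym (cong₂ (λ x y → x + y + + 0) (binom-negʳ (+ a) r) (binom-negʳ (+ a) (suc r)))
  binom-pascal (+ suc a) (+ zero) = cong (λ x → x + + 0 + + 0) (sym (binom-+ a 0))
  binom-pascal (+ suc a) (+ suc r) = begin
    binom (+ suc a) (+ suc r)                        ≡⟨ binom-+ (suc a) (suc r) ⟩
    + (suc a C suc r)                                ≡⟨ cong +_ (sym (nCk+nC[k+1]≡[n+1]C[k+1] a r)) ⟩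
    + (a C r) + + (a C suc r)                        ≡⟨ ℤP.+-comm (+ (a C r)) (+ (a C suc r)) ⟩
    + (a C suc r) + + (a C r)                        ≡⟨ sym (ℤP.+-identityʳ _) ⟩
    + (a C suc r) + + (a C r) + + 0                  ≡⟨ cong₂ (λ x y → x + y + + 0) (sym (binom-+ a (suc r))) (sym (binom-+ a r)) ⟩
    binom (+ a) (+ suc r) + binom (+ a) (+ r) + + 0  ∎
    where open ≡-Reasoning

  sumTo-cong : ∀ B {f g : ℕ → ℤ} → (∀ j → f j ≡ g j) → sumTo B f ≡ sumTo B g
  sumTo-cong zero f≗g = f≗g 0
  sumTo-cong (suc B) f≗g = cong₂ _+_ (sumTo-cong B f≗g) (f≗g (suc B))

  sumTo-+ : ∀ B (f g : ℕ → ℤ) → sumTo B (λ j → f j + g j) ≡ sumTo B f + sumTo B g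
  sumTo-+ zero f g = refl
  sumTo-+ (suc B) f g = trans (cong (_+ (f (suc B) + g (suc B))) (sumTo-+ B f g)) (swap (sumTo B f) (sumTo B g) _ _)
    where
    swap : ∀ a b c d → a + b + (c + d) ≡ a + c + (b + d)
    swap = solve-∀

  sumTo-- : ∀ B (f g : ℕ → ℤ) → sumTo B (λ j → f j - g j) ≡ sumTo B f - sumTo B g
  sumTo-- zero f g = refl
  sumTo-- (suc B) f g = trans (cong (_+ (f (suc B) - g (suc B))) (sumTo-- B f g)) (swap (sumTo B f) (sumTo B g) _ _)
    where
    swap : ∀ a b c d → a - b + (c - d) ≡ a + c - (b + d)
    swap = solve-∀

  sumTo-telescope : ∀ B (u : ℕ → ℤ) → sumTo B (λ j → u j - u (suc j)) ≡ u 0 - u (suc B)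
  sumTo-telescope zero u = refl
  sumTo-telescope (suc B) u = trans (cong (_+ (u (suc B) - u (suc (suc B)))) (sumTo-telescope B u)) (cancel (u 0) _ _)
    where
    cancel : ∀ a b c → a - b + (b - c) ≡ a - c
    cancel = solve-∀

  sumTo-suc : ∀ B (f : ℕ → ℤ) → sumTo (suc B) f ≡ f 0 + sumTo B (λ j → f (suc j))
  sumTo-suc zero f = refl
  sumTo-suc (suc B) f = trans (cong (_+ f (suc (suc B))) (sumTo-suc B f)) (ℤP.+-assoc (f 0) _ _)

  sumTo-zero : ∀ B {f : ℕ → ℤ} → (∀ j → f j ≡ + 0) → sumTo B f ≡ + 0
  sumTo-zero zero f≗0 = f≗0 0
  sumTo-zero (suc B) f≗0 = cong₂ _+_ (sumTo-zero B f≗0) (f≗0 (suc B))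

  sumTo-extend : ∀ {k} {f : ℕ → ℤ} → (∀ j → k ℕ.< j → f j ≡ + 0) → ∀ B → k ℕ.≤ B → sumTo B f ≡ sumTo k f
  sumTo-extend f≗0 B k≤B with ℕP.m≤n⇒m<n∨m≡n k≤B
  ... | inj₂ refl = refl
  sumTo-extend f≗0 (suc B) _ | inj₁ (ℕ.s≤s k≤B) =
    trans (cong₂ _+_ (sumTo-extend f≗0 B k≤B) (f≗0 (suc B) (ℕ.s≤s k≤B))) (ℤP.+-identityʳ _)

  term : ℤ → ℤ → ℕ → ℤ
  term N K j = binom (N - + 2 * + j) (K - + j) * binom (+ j) (N - K - + j)

  termSum : ℤ → ℤ → ℤ
  termSum N (+ k) = sumTo k (term N (+ k))
  termSum N -[1+ _ ] = + 0

  term-≡ : ∀ N K j {a b c} → N - + 2 * + j ≡ a → K - + j ≡ b → N - K - + j ≡ c →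
           term N K j ≡ binom a b * binom (+ j) c
  term-≡ N K j refl refl refl = refl

  term-negK : ∀ N r j → term N -[1+ r ] j ≡ + 0
  term-negK N r zero = cong (_* binom (+ 0) (N - -[1+ r ] - + 0)) (binom-negʳ (N - + 2 * + 0) r)
  term-negK N r (suc j) = cong (_* binom (+ suc j) (N - -[1+ r ] - + suc j)) (binom-negʳ (N - + 2 * + suc j) (suc (r ℕ.+ j)))

  term-beyond : ∀ N {k j} → k ℕ.< j → term N (+ k) j ≡ + 0
  term-beyond N {k} {j} k<j = cong (_* binom (+ j) (N - + k - + j)) (binom-<ʳ (N - + 2 * + j) k<j)

  termSum-sumTo : ∀ N K B → K ≤ + B → sumTo B (term N K) ≡ termSum N K
  termSum-sumTo N (+ k) B (+≤+ k≤B) = sumTo-extend (λ _ → term-beyond N) B k≤B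
  termSum-sumTo N -[1+ r ] B _ = sumTo-zero B (term-negK N r)

  binom-pascal-* : ∀ m r c → binom m r * c - binom (m - + 1) (r - + 1) * c ≡ binom (m - + 1) r * c + δ₀ m r * c
  binom-pascal-* m r c = trans (cong (λ t → t * c - binom (m - + 1) (r - + 1) * c) (binom-pascal m r))
                               (cancel (binom (m - + 1) r) (binom (m - + 1) (r - + 1)) (δ₀ m r) c)
    where
    cancel : ∀ p b e c → (p + b + e) * c - b * c ≡ p * c + e * c
    cancel = solve-∀

  lowerTerm : ℤ → ℤ → ℕ → ℤ
  lowerTerm N K j = binom (N - + 2 * + j - + 1) (K - + j) * binom (+ j - + 1) (N - K - + j - + 1)

  carryTerm : ℤ → ℤ → ℕ → ℤ
  carryTerm N K j = binom (N - + 2 * + j - + 1) (K - + j) * binom (+ j - + 1) (N - K - + j)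
                  + δ₀ (N - + 2 * + j) (K - + j) * binom (+ j) (N - K - + j)

  term-difference₁ : ∀ N K j → term N K j - term (N - + 1) (K - + 1) j ≡ lowerTerm N K j + carryTerm N K j
  term-difference₁ N K j = begin
    term N K j - term (N - + 1) (K - + 1) j
      ≡⟨ cong (λ t → term N K j - t) (term-≡ (N - + 1) (K - + 1) j (i₁ N J) (i₂ K J) (i₃ N K J)) ⟩
    binom x y * B - binom (x - + 1) (y - + 1) * B
      ≡⟨ binom-pascal-* x y B ⟩
    p * B + δ₀ x y * B
      ≡⟨ cong (λ t → p * t + δ₀ x y * B) (binom-pascal J z) ⟩
    p * (q₁ + q₂ + δ₀ J z) + δ₀ x y * B
      ≡⟨ regroup p q₁ q₂ (δ₀ J z) (δ₀ x y * B) ⟩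
    p * q₂ + (p * q₁ + δ₀ x y * B) + p * δ₀ J z
      ≡⟨ cong (_+_ (p * q₂ + (p * q₁ + δ₀ x y * B))) vanish ⟩
    p * q₂ + (p * q₁ + δ₀ x y * B) + + 0
      ≡⟨ ℤP.+-identityʳ _ ⟩
    lowerTerm N K j + carryTerm N K j ∎
    where
    open ≡-Reasoning
    J = + j
    x = N - + 2 * J
    y = K - J
    z = N - K - J
    B = binom J z
    p = binom (x - + 1) y
    q₁ = binom (J - + 1) z
    q₂ = binom (J - + 1) (z - + 1)
    i₁ : ∀ N J → N - + 1 - + 2 * J ≡ N - + 2 * J - + 1
    i₁ = solve-∀
    i₂ : ∀ K J → K - + 1 - J ≡ K - J - + 1
    i₂ = solve-∀
    i₃ : ∀ N K J → N - + 1 - (K - + 1) - J ≡ N - K - J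
    i₃ = solve-∀
    regroup : ∀ p a b e D → p * (a + b + e) + D ≡ p * b + (p * a + D) + p * e
    regroup = solve-∀
    -- at j = 0 and K = N the factor p is binom (N - 1) N = 0
    vanish : p * δ₀ J z ≡ + 0
    vanish = trans (ℤP.*-comm p (δ₀ J z)) (trans (δ₀-*-cong J z at-origin) (ℤP.*-zeroʳ (δ₀ J z)))
      where
      at-origin : J ≡ + 0 → z ≡ + 0 → p ≡ + 0
      at-origin refl z≡0 = trans (cong₂ binom (i₄ N) K≡N) (binom-pred-self N)
        where
        i₄ : ∀ N → N - + 2 * + 0 - + 1 ≡ N - + 1
        i₄ = solve-∀
        i₅ : ∀ N K → K - + 0 ≡ N - (N - K - + 0)
        i₅ = solve-∀
        K≡N : K - + 0 ≡ N
        K≡N = trans (i₅ N K) (trans (cong (λ t → N - t) z≡0) (ℤP.+-identityʳ N))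

  term-difference₂ : ∀ N K j → term (N - + 2) (K - + 1) j - term (N - + 3) (K - + 2) j ≡ carryTerm N K (suc j)
  term-difference₂ N K j = begin
    term (N - + 2) (K - + 1) j - term (N - + 3) (K - + 2) j
      ≡⟨ cong₂ _-_ (term-≡ (N - + 2) (K - + 1) j (i₁ N J) (i₂ K J) (i₃ N K J))
                   (term-≡ (N - + 3) (K - + 2) j (i₄ N J) (i₅ K J) (i₆ N K J)) ⟩
    binom m r * C - binom (m - + 1) (r - + 1) * C
      ≡⟨ binom-pascal-* m r C ⟩
    binom (m - + 1) r * C + δ₀ m r * C
      ≡⟨ cong (_+_ (binom (m - + 1) r * C)) (δ₀-*-cong m r at-origin) ⟩
    carryTerm N K (suc j) ∎
    where
    open ≡-Reasoning
    J = + j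
    m = N - + 2 * + suc j
    r = K - + suc j
    c = N - K - + suc j
    C = binom J c
    i₁ : ∀ N J → N - + 2 - + 2 * J ≡ N - + 2 * (+ 1 + J)
    i₁ = solve-∀
    i₂ : ∀ K J → K - + 1 - J ≡ K - (+ 1 + J)
    i₂ = solve-∀
    i₃ : ∀ N K J → N - + 2 - (K - + 1) - J ≡ N - K - (+ 1 + J)
    i₃ = solve-∀
    i₄ : ∀ N J → N - + 3 - + 2 * J ≡ N - + 2 * (+ 1 + J) - + 1
    i₄ = solve-∀
    i₅ : ∀ K J → K - + 2 - J ≡ K - (+ 1 + J) - + 1
    i₅ = solve-∀
    i₆ : ∀ N K J → N - + 3 - (K - + 2) - J ≡ N - K - (+ 1 + J)
    i₆ = solve-∀
    i₇ : ∀ m r c → c ≡ m - r → m ≡ + 0 → r ≡ + 0 → c ≡ + 0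
    i₇ m r c refl refl refl = refl
    i₈ : ∀ N K J → N - K - (+ 1 + J) ≡ N - + 2 * (+ 1 + J) - (K - (+ 1 + J))
    i₈ = solve-∀
    -- at m = r = 0 also c = 0, where binom j c = binom (j + 1) c = 1
    at-origin : m ≡ + 0 → r ≡ + 0 → C ≡ binom (+ suc j) c
    at-origin m≡0 r≡0 rewrite i₇ m r c (i₈ N K J) m≡0 r≡0 = trans (binom-+ j 0) (sym (binom-+ (suc j) 0))

  term-telescoping : ∀ N K j →
    term N K j - term (N - + 1) (K - + 1) j - term (N - + 2) (K - + 1) j + term (N - + 3) (K - + 2) j
    ≡ lowerTerm N K j + (carryTerm N K j - carryTerm N K (suc j))
  term-telescoping N K j = begin
    t₀ - t₁ - t₂ + t₃      ≡⟨ regroup t₀ t₁ t₂ t₃ ⟩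
    (t₀ - t₁) - (t₂ - t₃)  ≡⟨ cong₂ _-_ (term-difference₁ N K j) (term-difference₂ N K j) ⟩
    w + u - u⁺             ≡⟨ ℤP.+-assoc w u (- u⁺) ⟩
    w + (u - u⁺)           ∎
    where
    open ≡-Reasoning
    t₀ = term N K j
    t₁ = term (N - + 1) (K - + 1) j
    t₂ = term (N - + 2) (K - + 1) j
    t₃ = term (N - + 3) (K - + 2) j
    w = lowerTerm N K j
    u = carryTerm N K j
    u⁺ = carryTerm N K (suc j)
    regroup : ∀ a b c d → a - b - c + d ≡ (a - b) - (c - d)
    regroup = solve-∀

  sumTo-lowerTerm : ∀ N k → sumTo k (lowerTerm N (+ k)) ≡ termSum (N - + 3) (+ k - + 1)
  sumTo-lowerTerm N zero = ℤP.*-zeroʳ (binom (N - + 2 * + 0 - + 1) (+ 0 - + 0))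
  sumTo-lowerTerm N (suc k) = begin
    sumTo (suc k) (lowerTerm N K)                          ≡⟨ sumTo-suc k (lowerTerm N K) ⟩
    lowerTerm N K 0 + sumTo k (λ j → lowerTerm N K (suc j)) ≡⟨ cong₂ _+_ (ℤP.*-zeroʳ (binom (N - + 2 * + 0 - + 1) (K - + 0)))
                                                                         (sumTo-cong k (λ j → sym (term-≡ (N - + 3) (+ k) j (i₁ N (+ j)) (i₂ (+ k) (+ j)) (i₃ N (+ k) (+ j))))) ⟩
    + 0 + sumTo k (term (N - + 3) (+ k))                     ≡⟨ ℤP.+-identityˡ _ ⟩
    termSum (N - + 3) (+ k)                                 ∎
    where
    open ≡-Reasoning
    K = + suc k
    i₁ : ∀ N J → N - + 3 - + 2 * J ≡ N - + 2 * (+ 1 + J) - + 1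
    i₁ = solve-∀
    i₂ : ∀ K J → K - J ≡ + 1 + K - (+ 1 + J)
    i₂ = solve-∀
    i₃ : ∀ N K J → N - + 3 - K - J ≡ N - (+ 1 + K) - (+ 1 + J) - + 1
    i₃ = solve-∀

  carryTerm-zero : ∀ N K → carryTerm N K 0 ≡ δ₀ N K
  carryTerm-zero N K = begin
    carryTerm N K 0                                       ≡⟨ cong (_+ δ₀ (N - + 2 * + 0) (K - + 0) * B) (ℤP.*-zeroʳ (binom (N - + 2 * + 0 - + 1) (K - + 0))) ⟩
    + 0 + δ₀ (N - + 2 * + 0) (K - + 0) * B                 ≡⟨ ℤP.+-identityˡ _ ⟩
    δ₀ (N - + 2 * + 0) (K - + 0) * B                       ≡⟨ cong₂ (λ m r → δ₀ m r * B) (i₁ N) (i₂ K) ⟩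
    δ₀ N K * B                                            ≡⟨ δ₀-*-cong N K at-origin ⟩
    δ₀ N K * + 1                                          ≡⟨ ℤP.*-identityʳ (δ₀ N K) ⟩
    δ₀ N K                                                ∎
    where
    open ≡-Reasoning
    B = binom (+ 0) (N - K - + 0)
    i₁ : ∀ N → N - + 2 * + 0 ≡ N
    i₁ = solve-∀
    i₂ : ∀ K → K - + 0 ≡ K
    i₂ = solve-∀
    at-origin : N ≡ + 0 → K ≡ + 0 → B ≡ + 1
    at-origin refl refl = refl

  carryTerm-beyond : ∀ N k → carryTerm N (+ k) (suc k) ≡ + 0
  carryTerm-beyond N k = cong₂ _+_
    (cong (_* binom (+ k) (N - + k - + suc k)) (binom-<ʳ (N - + 2 * + suc k - + 1) (ℕP.n<1+n k)))
    (cong (_* binom (+ suc k) (N - + k - + suc k)) negative-δ₀)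
    where
    negative-δ₀ : δ₀ (N - + 2 * + suc k) (+ k - + suc k) ≡ + 0
    negative-δ₀ = trans (cong (δ₀ _) (-≡-[1+∸] (ℕP.n<1+n k))) (δ₀-negʳ _ _)

  termSum-recurrence : ∀ N K →
    termSum N K ≡ termSum (N - + 1) (K - + 1) + termSum (N - + 2) (K - + 1) + termSum (N - + 3) (K - + 1)
                - termSum (N - + 3) (K - + 2) + δ₀ N K
  termSum-recurrence N -[1+ r ] rewrite δ₀-negʳ N r = refl
  termSum-recurrence N (+ k) = solve-for-T₀ (trans (sym summed-left) (trans (sumTo-cong k (term-telescoping N K)) summed-right))
    where
    K = + k
    T₀ = termSum N K
    T₁ = termSum (N - + 1) (K - + 1)
    T₂ = termSum (N - + 2) (K - + 1)
    T₃ = termSum (N - + 3) (K - + 1)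
    T₄ = termSum (N - + 3) (K - + 2)
    summed-left : sumTo k (λ j → term N K j - term (N - + 1) (K - + 1) j - term (N - + 2) (K - + 1) j + term (N - + 3) (K - + 2) j)
                  ≡ T₀ - T₁ - T₂ + T₄
    summed-left = trans (sumTo-+ k _ _) (cong₂ _+_ (trans (sumTo-- k _ _) (cong₂ _-_ (trans (sumTo-- k _ _)
        (cong₂ _-_ (termSum-sumTo N K k ℤP.≤-refl) (termSum-sumTo (N - + 1) (K - + 1) k (ℤP.i-j≤i K (+ 1)))))
        (termSum-sumTo (N - + 2) (K - + 1) k (ℤP.i-j≤i K (+ 1)))))
        (termSum-sumTo (N - + 3) (K - + 2) k (ℤP.i-j≤i K (+ 2))))
    summed-right : sumTo k (λ j → lowerTerm N K j + (carryTerm N K j - carryTerm N K (suc j))) ≡ T₃ + (δ₀ N K - + 0)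
    summed-right = trans (sumTo-+ k _ _) (cong₂ _+_ (sumTo-lowerTerm N k)
        (trans (sumTo-telescope k (carryTerm N K)) (cong₂ _-_ (carryTerm-zero N K) (carryTerm-beyond N k))))
    solve-for-T₀ : T₀ - T₁ - T₂ + T₄ ≡ T₃ + (δ₀ N K - + 0) → T₀ ≡ T₁ + T₂ + T₃ - T₄ + δ₀ N K
    solve-for-T₀ e = trans (l₁ T₀ T₁ T₂ T₄) (trans (cong (λ t → t + T₁ + T₂ - T₄) e) (l₂ T₁ T₂ T₃ T₄ (δ₀ N K)))
      where
      l₁ : ∀ a b c d → a ≡ (a - b - c + d) + b + c - d
      l₁ = solve-∀
      l₂ : ∀ b c e d f → e + (f - + 0) + b + c - d ≡ b + c + e - d + f
      l₂ = solve-∀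

  rhsℤ : ℤ → ℤ → ℤ
  rhsℤ N K = termSum N K + termSum (N - + 1) K - termSum (N - + 2) (K - + 2)

  rhs≡rhsℤ : ∀ n k → rhs n k ≡ rhsℤ (+ n) (+ k)
  rhs≡rhsℤ n k = trans (sumTo-cong k summand) (trans (sumTo-- k _ _) (cong₂ _-_ (trans (sumTo-+ k _ _)
      (cong₂ _+_ (termSum-sumTo N K k ℤP.≤-refl) (termSum-sumTo (N - + 1) K k ℤP.≤-refl)))
      (termSum-sumTo (N - + 2) (K - + 2) k (ℤP.i-j≤i K (+ 2)))))
    where
    N = + n
    K = + k
    summand : ∀ j → term N K j + binom (N - + 2 * + j - + 1) (K - + j) * binom (+ j) (N - K - + j - + 1)
                      - binom (N - + 2 * + j - + 2) (K - + j - + 2) * binom (+ j) (N - K - + j)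
                    ≡ term N K j + term (N - + 1) K j - term (N - + 2) (K - + 2) j
    summand j = cong₂ (λ a b → term N K j + a - b)
      (sym (term-≡ (N - + 1) K j (i₁ N (+ j)) refl (i₂ N K (+ j))))
      (sym (term-≡ (N - + 2) (K - + 2) j (i₃ N (+ j)) (i₄ K (+ j)) (i₅ N K (+ j))))
      where
      i₁ : ∀ N J → N - + 1 - + 2 * J ≡ N - + 2 * J - + 1
      i₁ = solve-∀
      i₂ : ∀ N K J → N - + 1 - K - J ≡ N - K - J - + 1
      i₂ = solve-∀
      i₃ : ∀ N J → N - + 2 - + 2 * J ≡ N - + 2 * J - + 2
      i₃ = solve-∀
      i₄ : ∀ K J → K - + 2 - J ≡ K - J - + 2
      i₄ = solve-∀
      i₅ : ∀ N K J → N - + 2 - (K - + 2) - J ≡ N - K - J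
      i₅ = solve-∀

  module _ (M K : ℤ) where
    private
      T : ℕ → ℕ → ℤ
      T i j = termSum (M - + i) (K - + j)

      offset : ∀ M I c → M - I - c ≡ M - (c + I)
      offset = solve-∀

      T-recurrence : ∀ i j → T i j ≡ T (1 ℕ.+ i) (1 ℕ.+ j) + T (2 ℕ.+ i) (1 ℕ.+ j) + T (3 ℕ.+ i) (1 ℕ.+ j)
                                     - T (3 ℕ.+ i) (2 ℕ.+ j) + δ₀ (M - + i) (K - + j)
      T-recurrence i j = trans (termSum-recurrence (M - + i) (K - + j))
        (cong₂ (λ a b → a - b + δ₀ (M - + i) (K - + j))
          (cong₂ _+_ (cong₂ _+_ (cong₂ termSum (offset M (+ i) (+ 1)) (offset K (+ j) (+ 1)))
                                (cong₂ termSum (offset M (+ i) (+ 2)) (offset K (+ j) (+ 1))))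
                     (cong₂ termSum (offset M (+ i) (+ 3)) (offset K (+ j) (+ 1))))
          (cong₂ termSum (offset M (+ i) (+ 3)) (offset K (+ j) (+ 2))))

      rhsℤ-offset : ∀ a b → rhsℤ (M - + a) (K - + b) ≡ T a b + T (1 ℕ.+ a) b - T (2 ℕ.+ a) (2 ℕ.+ b)
      rhsℤ-offset a b = cong₂ (λ x y → T a b + x - y) (cong (λ t → termSum t (K - + b)) (offset M (+ a) (+ 1)))
                                                       (cong₂ termSum (offset M (+ a) (+ 2)) (offset K (+ b) (+ 2)))

    rhsℤ-recurrence : δ₀ (M - + 0) (K - + 0) ≡ + 0 → δ₀ (M - + 1) (K - + 0) ≡ + 0 → δ₀ (M - + 2) (K - + 2) ≡ + 0 →
      rhsℤ (M - + 0) (K - + 0) ≡ rhsℤ (M - + 1) (K - + 1) + rhsℤ (M - + 2) (K - + 1) + rhsℤ (M - + 3) (K - + 1) - rhsℤ (M - + 3) (K - + 2)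
    rhsℤ-recurrence δ₀₀≡0 δ₁₀≡0 δ₂₂≡0 = begin
      rhsℤ (M - + 0) (K - + 0)
        ≡⟨ rhsℤ-offset 0 0 ⟩
      T 0 0 + T 1 0 - T 2 2
        ≡⟨ cong₂ _-_ (cong₂ _+_ (trans (T-recurrence 0 0) (cong (_+_ R₀) δ₀₀≡0)) (trans (T-recurrence 1 0) (cong (_+_ R₁) δ₁₀≡0)))
                     (trans (T-recurrence 2 2) (cong (_+_ R₂) δ₂₂≡0)) ⟩
      (R₀ + + 0) + (R₁ + + 0) - (R₂ + + 0)
        ≡⟨ regroup (T 1 1) (T 2 1) (T 3 1) (T 3 2) (T 4 1) (T 4 2) (T 3 3) (T 4 3) (T 5 3) (T 5 4) ⟩
      (T 1 1 + T 2 1 - T 3 3) + (T 2 1 + T 3 1 - T 4 3) + (T 3 1 + T 4 1 - T 5 3) - (T 3 2 + T 4 2 - T 5 4)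
        ≡⟨ sym (cong₂ _-_ (cong₂ _+_ (cong₂ _+_ (rhsℤ-offset 1 1) (rhsℤ-offset 2 1)) (rhsℤ-offset 3 1)) (rhsℤ-offset 3 2)) ⟩
      rhsℤ (M - + 1) (K - + 1) + rhsℤ (M - + 2) (K - + 1) + rhsℤ (M - + 3) (K - + 1) - rhsℤ (M - + 3) (K - + 2) ∎
      where
      open ≡-Reasoning
      R₀ = T 1 1 + T 2 1 + T 3 1 - T 3 2
      R₁ = T 2 1 + T 3 1 + T 4 1 - T 4 2
      R₂ = T 3 3 + T 4 3 + T 5 3 - T 5 4
      regroup : ∀ a₁₁ a₂₁ a₃₁ a₃₂ a₄₁ a₄₂ a₃₃ a₄₃ a₅₃ a₅₄ →
        (a₁₁ + a₂₁ + a₃₁ - a₃₂ + + 0) + (a₂₁ + a₃₁ + a₄₁ - a₄₂ + + 0) - (a₃₃ + a₄₃ + a₅₃ - a₅₄ + + 0)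
        ≡ (a₁₁ + a₂₁ - a₃₃) + (a₂₁ + a₃₁ - a₄₃) + (a₃₁ + a₄₁ - a₅₃) - (a₃₂ + a₄₂ - a₅₄)
      regroup = solve-∀

  shift : (ℕ → ℤ) → ℕ → ℤ
  shift f zero = + 0
  shift f (suc k) = f k

  rhs-recurrence : ∀ n k → rhs (3 ℕ.+ n) k ≡ shift (rhs (2 ℕ.+ n)) k + shift (rhs (1 ℕ.+ n)) k + shift (rhs n) k
                                             - shift (shift (rhs n)) k
  rhs-recurrence n k = begin
    rhs (3 ℕ.+ n) k
      ≡⟨ rhs≡rhsℤ (3 ℕ.+ n) k ⟩
    rhsℤ M K
      ≡⟨ cong₂ rhsℤ (sym (ℤP.+-identityʳ M)) (sym (ℤP.+-identityʳ K)) ⟩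
    rhsℤ (M - + 0) (K - + 0)
      ≡⟨ rhsℤ-recurrence M K refl refl refl ⟩
    rhsℤ (M - + 1) (K - + 1) + rhsℤ (M - + 2) (K - + 1) + rhsℤ (M - + 3) (K - + 1) - rhsℤ (M - + 3) (K - + 2)
      ≡⟨ sym (cong₂ _-_ (cong₂ _+_ (cong₂ _+_ (shift-rhs (2 ℕ.+ n) k) (shift-rhs (1 ℕ.+ n) k)) (shift-rhs n k)) (shift²-rhs n k)) ⟩
    shift (rhs (2 ℕ.+ n)) k + shift (rhs (1 ℕ.+ n)) k + shift (rhs n) k - shift (shift (rhs n)) k ∎
    where
    open ≡-Reasoning
    M = + (3 ℕ.+ n)
    K = + k
    shift-rhs : ∀ m k → shift (rhs m) k ≡ rhsℤ (+ m) (+ k - + 1)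
    shift-rhs m zero = refl
    shift-rhs m (suc k) = rhs≡rhsℤ m k
    shift²-rhs : ∀ m k → shift (shift (rhs m)) k ≡ rhsℤ (+ m) (+ k - + 2)
    shift²-rhs m zero = refl
    shift²-rhs m (suc zero) = refl
    shift²-rhs m (suc (suc k)) = rhs≡rhsℤ m k

  binom-beyond : ∀ m e r → r ≡ m + + suc e → binom m r ≡ + 0
  binom-beyond -[1+ _ ] e r _ = refl
  binom-beyond (+ a) e r refl = trans (binom-+ a (a ℕ.+ suc e)) (cong +_ (k>n⇒nCk≡0 (ℕP.m<m+n a (ℕ.s≤s ℕ.z≤n))))

  termSum-beyond : ∀ N K e → K ≡ N + + suc e → termSum N K ≡ + 0
  termSum-beyond N -[1+ _ ] e _ = refl
  termSum-beyond N (+ k) e K≡N+1+e = sumTo-zero k (λ j → cong (_* binom (+ j) (N - + k - + j))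
    (binom-beyond (N - + 2 * + j) (e ℕ.+ j) (+ k - + j) (trans (cong (_- + j) K≡N+1+e) (i₁ N (+ e) (+ j)))))
    where
    i₁ : ∀ N E J → N + (+ 1 + E) - J ≡ N - + 2 * J + (+ 1 + E + J)
    i₁ = solve-∀

  rhs-beyond : ∀ n e → rhs n (n ℕ.+ suc e) ≡ + 0
  rhs-beyond n e = trans (rhs≡rhsℤ n (n ℕ.+ suc e)) (cong₂ _-_
    (cong₂ _+_ (termSum-beyond N K e refl) (termSum-beyond (N - + 1) K (suc e) (i₁ N (+ e))))
    (termSum-beyond (N - + 2) (K - + 2) e (i₂ N (+ e))))
    where
    N = + n
    K = + (n ℕ.+ suc e)
    i₁ : ∀ N E → N + (+ 1 + E) ≡ N - + 1 + (+ 1 + (+ 1 + E))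
    i₁ = solve-∀
    i₂ : ∀ N E → N + (+ 1 + E) - + 2 ≡ N - + 2 + (+ 1 + E)
    i₂ = solve-∀

module FilterDegrees where

  open import Data.Bool using (Bool; true; false; not; _∧_; _∨_; if_then_else_)
  open import Data.Bool.Properties using (∧-zeroʳ; ∧-identityʳ; not-involutive)
  open import Data.Empty using (⊥-elim)
  open import Data.Fin using (Fin; toℕ; fromℕ<) renaming (zero to fzero; suc to fsuc)
  open import Data.Fin.Properties using (toℕ<n; toℕ-fromℕ<)
  open import Data.Fin.Subset using (Subset; _∈_)
  open import Data.List using (List; []; _∷_; map; _++_; filter; length)
  open import Data.Nat using (ℕ; zero; suc; _+_; _*_; _∸_; _≤_; _<_; _≡ᵇ_; z≤n; s≤s)
  import Data.Nat.Properties as ℕP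
  open import Data.Nat.Tactic.RingSolver using (solve-∀)
  open import Data.Product using (Σ; _×_; _,_; proj₁; proj₂)
  open import Data.Sum using (_⊎_; inj₁; inj₂)
  open import Data.Vec using (Vec; []; _∷_; _∷ʳ_; here; there)
  open import Algebra.Properties.CommutativeSemigroup ℕP.+-commutativeSemigroup using () renaming (interchange to +-interchange)
  open import Function using (_∘_)
  open import Relation.Binary.Construct.Closure.ReflexiveTransitive using (ε; _◅_)
  open import Relation.Binary.PropositionalEquality
  open import Relation.Nullary using (Dec; yes; no; does)
  open import Relation.Unary using (Pred; Decidable)

  boolToℕ : Bool → ℕ
  boolToℕ true = 1
  boolToℕ false = 0

  countᵇ : {A : Set} → (A → Bool) → List A → ℕ
  countᵇ p [] = 0
  countᵇ p (x ∷ xs) = boolToℕ (p x) + countᵇ p xs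

  module _ {A : Set} where

    length-filter≡countᵇ : ∀ {ℓ} {P : Pred A ℓ} (P? : Decidable P) xs → length (filter P? xs) ≡ countᵇ (does ∘ P?) xs
    length-filter≡countᵇ P? [] = refl
    length-filter≡countᵇ P? (x ∷ xs) with does (P? x)
    ... | true = cong suc (length-filter≡countᵇ P? xs)
    ... | false = length-filter≡countᵇ P? xs

    countᵇ-filter : ∀ {ℓ} {P : Pred A ℓ} (P? : Decidable P) (q : A → Bool) xs →
                    countᵇ q (filter P? xs) ≡ countᵇ (λ x → does (P? x) ∧ q x) xs
    countᵇ-filter P? q [] = refl
    countᵇ-filter P? q (x ∷ xs) with does (P? x)
    ... | true = cong (boolToℕ (q x) +_) (countᵇ-filter P? q xs)
    ... | false = countᵇ-filter P? q xs

    countᵇ-cong : ∀ {p q : A → Bool} → (∀ x → p x ≡ q x) → ∀ xs → countᵇ p xs ≡ countᵇ q xs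
    countᵇ-cong p≗q [] = refl
    countᵇ-cong p≗q (x ∷ xs) = cong₂ _+_ (cong boolToℕ (p≗q x)) (countᵇ-cong p≗q xs)

    countᵇ-++ : ∀ (p : A → Bool) xs ys → countᵇ p (xs ++ ys) ≡ countᵇ p xs + countᵇ p ys
    countᵇ-++ p [] ys = refl
    countᵇ-++ p (x ∷ xs) ys = trans (cong (boolToℕ (p x) +_) (countᵇ-++ p xs ys)) (sym (ℕP.+-assoc (boolToℕ (p x)) _ _))

    countᵇ-map : ∀ {B : Set} (p : B → Bool) (f : A → B) xs → countᵇ p (map f xs) ≡ countᵇ (p ∘ f) xs
    countᵇ-map p f [] = refl
    countᵇ-map p f (x ∷ xs) = cong (boolToℕ (p (f x)) +_) (countᵇ-map p f xs)

    countᵇ-false : ∀ xs → countᵇ (λ (_ : A) → false) xs ≡ 0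
    countᵇ-false [] = refl
    countᵇ-false (x ∷ xs) = countᵇ-false xs

  countSubsets : ∀ n → (Subset n → Bool) → ℕ
  countSubsets n p = countᵇ p (subsets n)

  countSubsets-cong : ∀ n {p q : Subset n → Bool} → (∀ S → p S ≡ q S) → countSubsets n p ≡ countSubsets n q
  countSubsets-cong n p≗q = countᵇ-cong p≗q (subsets n)

  countSubsets-false : ∀ n {p : Subset n → Bool} → (∀ S → p S ≡ false) → countSubsets n p ≡ 0
  countSubsets-false n p≗false = trans (countSubsets-cong n p≗false) (countᵇ-false (subsets n))

  countSubsets-∷ : ∀ n (p : Subset (suc n) → Bool) →
                   countSubsets (suc n) p ≡ countSubsets n (p ∘ (true ∷_)) + countSubsets n (p ∘ (false ∷_))
  countSubsets-∷ n p = trans (countᵇ-++ p (map (true ∷_) (subsets n)) (map (false ∷_) (subsets n)))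
                             (cong₂ _+_ (countᵇ-map p _ (subsets n)) (countᵇ-map p _ (subsets n)))

  countSubsets-∷ʳ : ∀ n (p : Subset (suc n) → Bool) c →
                    countSubsets (suc n) p ≡ countSubsets n (λ S → p (S ∷ʳ c)) + countSubsets n (λ S → p (S ∷ʳ not c))
  countSubsets-∷ʳ n p true = split n p
    where
    split : ∀ n (p : Subset (suc n) → Bool) →
            countSubsets (suc n) p ≡ countSubsets n (λ S → p (S ∷ʳ true)) + countSubsets n (λ S → p (S ∷ʳ false))
    split zero p = cong (_+ (boolToℕ (p (false ∷ [])) + 0)) (sym (ℕP.+-identityʳ (boolToℕ (p (true ∷ [])))))
    split (suc n) p = begin
      countSubsets (suc (suc n)) p
        ≡⟨ countSubsets-∷ (suc n) p ⟩
      countSubsets (suc n) (p ∘ (true ∷_)) + countSubsets (suc n) (p ∘ (false ∷_))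
        ≡⟨ cong₂ _+_ (split n (p ∘ (true ∷_))) (split n (p ∘ (false ∷_))) ⟩
      (c true true + c true false) + (c false true + c false false)
        ≡⟨ +-interchange (c true true) (c true false) (c false true) (c false false) ⟩
      (c true true + c false true) + (c true false + c false false)
        ≡⟨ sym (cong₂ _+_ (countSubsets-∷ n (λ S → p (S ∷ʳ true))) (countSubsets-∷ n (λ S → p (S ∷ʳ false)))) ⟩
      countSubsets (suc n) (λ S → p (S ∷ʳ true)) + countSubsets (suc n) (λ S → p (S ∷ʳ false)) ∎
      where
      open ≡-Reasoning
      c : Bool → Bool → ℕ
      c a b = countSubsets n (λ S → p (a ∷ (S ∷ʳ b)))
  countSubsets-∷ʳ n p false =
    trans (countSubsets-∷ʳ n p true) (ℕP.+-comm (countSubsets n (λ S → p (S ∷ʳ true))) (countSubsets n (λ S → p (S ∷ʳ false))))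

  countSubsets-hamming≡0 : ∀ n (p : Subset n → Bool) S → countSubsets n (λ T → p T ∧ (hamming S T ≡ᵇ 0)) ≡ boolToℕ (p S)
  countSubsets-hamming≡0 zero p [] = trans (ℕP.+-identityʳ _) (cong boolToℕ (∧-identityʳ (p [])))
  countSubsets-hamming≡0 (suc n) p (true ∷ S) = begin
    countSubsets (suc n) (λ T → p T ∧ (hamming (true ∷ S) T ≡ᵇ 0))
      ≡⟨ countSubsets-∷ n _ ⟩
    countSubsets n (λ T → p (true ∷ T) ∧ (hamming S T ≡ᵇ 0)) + countSubsets n (λ T → p (false ∷ T) ∧ false)
      ≡⟨ cong₂ _+_ (countSubsets-hamming≡0 n (p ∘ (true ∷_)) S) (countSubsets-false n (∧-zeroʳ ∘ p ∘ (false ∷_))) ⟩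
    boolToℕ (p (true ∷ S)) + 0
      ≡⟨ ℕP.+-identityʳ _ ⟩
    boolToℕ (p (true ∷ S)) ∎
    where open ≡-Reasoning
  countSubsets-hamming≡0 (suc n) p (false ∷ S) =
    trans (countSubsets-∷ n _) (cong₂ _+_ (countSubsets-false n (∧-zeroʳ ∘ p ∘ (true ∷_))) (countSubsets-hamming≡0 n (p ∘ (false ∷_)) S))

  hamming-∷ʳ-same : ∀ {n} (S T : Subset n) c → hamming (S ∷ʳ c) (T ∷ʳ c) ≡ hamming S T
  hamming-∷ʳ-same [] [] true = refl
  hamming-∷ʳ-same [] [] false = refl
  hamming-∷ʳ-same (true ∷ S) (true ∷ T) c = hamming-∷ʳ-same S T c
  hamming-∷ʳ-same (false ∷ S) (false ∷ T) c = hamming-∷ʳ-same S T c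
  hamming-∷ʳ-same (true ∷ S) (false ∷ T) c = cong suc (hamming-∷ʳ-same S T c)
  hamming-∷ʳ-same (false ∷ S) (true ∷ T) c = cong suc (hamming-∷ʳ-same S T c)

  hamming-∷ʳ-not : ∀ {n} (S T : Subset n) c → hamming (S ∷ʳ c) (T ∷ʳ not c) ≡ suc (hamming S T)
  hamming-∷ʳ-not [] [] true = refl
  hamming-∷ʳ-not [] [] false = refl
  hamming-∷ʳ-not (true ∷ S) (true ∷ T) c = hamming-∷ʳ-not S T c
  hamming-∷ʳ-not (false ∷ S) (false ∷ T) c = hamming-∷ʳ-not S T c
  hamming-∷ʳ-not (true ∷ S) (false ∷ T) c = cong suc (hamming-∷ʳ-not S T c)
  hamming-∷ʳ-not (false ∷ S) (true ∷ T) c = cong suc (hamming-∷ʳ-not S T c)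

  -- A neighbour of S ∷ʳ c either keeps the last bit (and is T ∷ʳ c for a neighbour T of S) or is S ∷ʳ not c.
  countHamming1-∷ʳ : ∀ m (F : Subset (suc m) → Bool) (S : Subset m) c →
    countSubsets (suc m) (λ T → F T ∧ (hamming (S ∷ʳ c) T ≡ᵇ 1))
    ≡ countSubsets m (λ T → F (T ∷ʳ c) ∧ (hamming S T ≡ᵇ 1)) + boolToℕ (F (S ∷ʳ not c))
  countHamming1-∷ʳ m F S c = trans (countSubsets-∷ʳ m _ c) (cong₂ _+_ keep flip)
    where
    keep : countSubsets m (λ T → F (T ∷ʳ c) ∧ (hamming (S ∷ʳ c) (T ∷ʳ c) ≡ᵇ 1))
         ≡ countSubsets m (λ T → F (T ∷ʳ c) ∧ (hamming S T ≡ᵇ 1))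
    keep = countSubsets-cong m (λ T → cong (λ h → F (T ∷ʳ c) ∧ (h ≡ᵇ 1)) (hamming-∷ʳ-same S T c))
    flip : countSubsets m (λ T → F (T ∷ʳ not c) ∧ (hamming (S ∷ʳ c) (T ∷ʳ not c) ≡ᵇ 1)) ≡ boolToℕ (F (S ∷ʳ not c))
    flip = trans (countSubsets-cong m (λ T → cong (λ h → F (T ∷ʳ not c) ∧ (h ≡ᵇ 1)) (hamming-∷ʳ-not S T c)))
                 (countSubsets-hamming≡0 m (λ T → F (T ∷ʳ not c)) S)

  bitAt : ∀ {n} → Vec Bool n → ℕ → Bool
  bitAt [] _ = false
  bitAt (b ∷ v) zero = b
  bitAt (b ∷ v) (suc i) = bitAt v i

  bitAt-∷ʳ-< : ∀ {n} (U : Vec Bool n) c {i} → i < n → bitAt (U ∷ʳ c) i ≡ bitAt U i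
  bitAt-∷ʳ-< (b ∷ U) c {zero} _ = refl
  bitAt-∷ʳ-< (b ∷ U) c {suc i} (s≤s i<n) = bitAt-∷ʳ-< U c i<n

  bitAt-∷ʳ-last : ∀ {n} (U : Vec Bool n) c → bitAt (U ∷ʳ c) n ≡ c
  bitAt-∷ʳ-last [] c = refl
  bitAt-∷ʳ-last (b ∷ U) c = bitAt-∷ʳ-last U c

  ∈⇒bitAt : ∀ {n} {S : Subset n} {x : Fin n} → x ∈ S → bitAt S (toℕ x) ≡ true
  ∈⇒bitAt here = refl
  ∈⇒bitAt (there x∈S) = ∈⇒bitAt x∈S

  bitAt⇒∈ : ∀ {n} (S : Subset n) (x : Fin n) → bitAt S (toℕ x) ≡ true → x ∈ S
  bitAt⇒∈ (b ∷ S) fzero refl = here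
  bitAt⇒∈ (b ∷ S) (fsuc x) x∈S = there (bitAt⇒∈ S x x∈S)

  -- Positions are 0-based here, whereas Cov uses the 1-based indices of the paper.
  CoverClosed : ∀ {n} → Subset n → Set
  CoverClosed {n} S = ∀ a b → Cov (suc a) (suc b) → a < n → b < n → bitAt S a ≡ true → bitAt S b ≡ true

  IsFilter⇒CoverClosed : ∀ {n} (S : Subset n) → IsFilter S → CoverClosed S
  IsFilter⇒CoverClosed S filter a b cov a<n b<n a∈S =
    subst (λ t → bitAt S t ≡ true) (toℕ-fromℕ< b<n)
      (∈⇒bitAt (filter (x⋖y ◅ ε) (bitAt⇒∈ S x (subst (λ t → bitAt S t ≡ true) (sym (toℕ-fromℕ< a<n)) a∈S))))
    where
    x = fromℕ< a<n
    y = fromℕ< b<n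
    x⋖y : x ⋖ y
    x⋖y = subst₂ (λ p q → Cov (suc p) (suc q)) (sym (toℕ-fromℕ< a<n)) (sym (toℕ-fromℕ< b<n)) cov

  CoverClosed⇒IsFilter : ∀ {n} (S : Subset n) → CoverClosed S → IsFilter S
  CoverClosed⇒IsFilter S closed ε x∈S = x∈S
  CoverClosed⇒IsFilter S closed {x} (_◅_ {j = y} x⋖y y≤z) x∈S =
    CoverClosed⇒IsFilter S closed y≤z (bitAt⇒∈ S y (closed (toℕ x) (toℕ y) x⋖y (toℕ<n x) (toℕ<n y) (∈⇒bitAt x∈S)))

  evenᵇ : ℕ → Bool
  evenᵇ zero = true
  evenᵇ (suc n) = not (evenᵇ n)

  evenᵇ-2* : ∀ i → evenᵇ (2 * i) ≡ true
  evenᵇ-2* zero = refl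
  evenᵇ-2* (suc i) rewrite ℕP.+-suc i (i + 0) | evenᵇ-2* i = refl

  parity : ∀ n → Σ ℕ (λ i → (n ≡ 2 * i × evenᵇ n ≡ true) ⊎ (n ≡ suc (2 * i) × evenᵇ n ≡ false))
  parity n with halve n
    where
    halve : ∀ n → Σ ℕ (λ i → n ≡ 2 * i ⊎ n ≡ suc (2 * i))
    halve zero = 0 , inj₁ refl
    halve (suc n) with halve n
    ... | i , inj₁ n≡2i = i , inj₂ (cong suc n≡2i)
    ... | i , inj₂ n≡1+2i = suc i , inj₁ (trans (cong suc n≡1+2i) (sym (ℕP.*-suc 2 i)))
  ... | i , inj₁ refl = i , inj₁ (refl , evenᵇ-2* i)
  ... | i , inj₂ refl = i , inj₂ (refl , cong not (evenᵇ-2* i))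

  private
    data CovCases (p q : ℕ) : Set where
      c21 : p ≡ 2 → q ≡ 1 → CovCases p q
      c32 : p ≡ 3 → q ≡ 2 → CovCases p q
      c24 : p ≡ 2 → q ≡ 4 → CovCases p q
      c54 : p ≡ 5 → q ≡ 4 → CovCases p q
      cup : ∀ i → 3 ≤ i → p ≡ 2 * i ∸ 1 → q ≡ 2 * i → CovCases p q
      cdown : ∀ i → 3 ≤ i → p ≡ 2 * i + 1 → q ≡ 2 * i → CovCases p q

    casesOf : ∀ {p q} → Cov p q → CovCases p q
    casesOf Cov.c21 = c21 refl refl
    casesOf Cov.c32 = c32 refl refl
    casesOf Cov.c24 = c24 refl refl
    casesOf Cov.c54 = c54 refl refl
    casesOf (Cov.cup i 3≤i) = cup i 3≤i refl refl
    casesOf (Cov.cdown i 3≤i) = cdown i 3≤i refl refl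

    true≢false : true ≢ false
    true≢false ()

    1+2*i≡2*i+1 : ∀ i → suc (2 * i) ≡ 2 * i + 1
    1+2*i≡2*i+1 i = ℕP.+-comm 1 (2 * i)

  Cov-into-last : ∀ {a n} → a ≤ 4 + n → Cov (suc a) (5 + n) → evenᵇ (5 + n) ≡ true × a ≡ 3 + n
  Cov-into-last {a} {n} a≤4+n cov with casesOf cov
  ... | c21 _ ()
  ... | c32 _ ()
  ... | c24 _ ()
  ... | c54 _ ()
  ... | cup i _ p q = trans (cong evenᵇ q) (evenᵇ-2* i) , ℕP.suc-injective (trans p (cong (_∸ 1) (sym q)))
  ... | cdown i _ p q = ⊥-elim (ℕP.1+n≰n (subst (_≤ 4 + n) (sym 5+n≡a) a≤4+n))
    where
    5+n≡a : 5 + n ≡ a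
    5+n≡a = ℕP.suc-injective (trans (trans (cong suc q) (1+2*i≡2*i+1 i)) (sym p))

  Cov-out-of-last : ∀ {b n} → b ≤ 4 + n → Cov (5 + n) (suc b) → evenᵇ (5 + n) ≡ false × b ≡ 3 + n
  Cov-out-of-last {b} {n} b≤4+n cov with casesOf cov
  ... | c21 () _
  ... | c32 () _
  ... | c24 () _
  ... | c54 refl refl = refl , refl
  ... | cup i _ p q = ⊥-elim (ℕP.1+n≰n (subst (_≤ 4 + n) (trans (cong (_∸ 1) q) (sym p)) b≤4+n))
  ... | cdown i _ p q =
    trans (cong evenᵇ (trans p (sym (1+2*i≡2*i+1 i)))) (cong not (evenᵇ-2* i)) ,
    ℕP.suc-injective (ℕP.suc-injective (trans (cong suc q) (trans (1+2*i≡2*i+1 i) (sym p))))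

  Cov-up : ∀ m → evenᵇ (5 + m) ≡ true → Cov (4 + m) (5 + m)
  Cov-up m even with parity (5 + m)
  ... | _ , inj₂ (_ , odd) = ⊥-elim (true≢false (trans (sym even) odd))
  ... | zero , inj₁ (() , _)
  ... | suc zero , inj₁ (() , _)
  ... | suc (suc zero) , inj₁ (() , _)
  ... | i@(suc (suc (suc _))) , inj₁ (5+m≡2i , _) =
    subst₂ Cov (cong (_∸ 1) (sym 5+m≡2i)) (sym 5+m≡2i) (Cov.cup i (s≤s (s≤s (s≤s z≤n))))

  Cov-down : ∀ m → evenᵇ (5 + m) ≡ false → Cov (5 + m) (4 + m)
  Cov-down m odd with parity (5 + m)
  ... | _ , inj₁ (_ , even) = ⊥-elim (true≢false (trans (sym even) odd))
  ... | zero , inj₂ (() , _)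
  ... | suc zero , inj₂ (() , _)
  ... | suc (suc zero) , inj₂ (refl , _) = Cov.c54
  ... | i@(suc (suc (suc _))) , inj₂ (5+m≡1+2i , _) =
    subst₂ Cov (trans (sym (1+2*i≡2*i+1 i)) (sym 5+m≡1+2i)) (ℕP.suc-injective (sym 5+m≡1+2i)) (Cov.cdown i (s≤s (s≤s (s≤s z≤n))))

  -- The bits x, c of consecutive elements respect the cover between them, which is x < c if up and c < x otherwise.
  respects : Bool → Bool → Bool → Bool
  respects true x c = not x ∨ c
  respects false x c = not c ∨ x

  private
    respects-up⁻ : ∀ {x c} → respects true x c ≡ true → x ≡ true → c ≡ true
    respects-up⁻ {true} {true} _ _ = refl

    respects-down⁻ : ∀ {x c} → respects false x c ≡ true → c ≡ true → x ≡ true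
    respects-down⁻ {true} {true} _ _ = refl

    respects-up⁺ : ∀ x c → (x ≡ true → c ≡ true) → respects true x c ≡ true
    respects-up⁺ false c _ = refl
    respects-up⁺ true c x⇒c rewrite x⇒c refl = refl

    respects-down⁺ : ∀ x c → (c ≡ true → x ≡ true) → respects false x c ≡ true
    respects-down⁺ x false _ = refl
    respects-down⁺ x true c⇒x rewrite c⇒x refl = refl

  module _ (m : ℕ) (U : Vec Bool (4 + m)) (c : Bool) where
    private
      x = bitAt U (3 + m)

      bit-< : ∀ {i} → i < 4 + m → bitAt (U ∷ʳ c) i ≡ bitAt U i
      bit-< = bitAt-∷ʳ-< U c

      bit-x : bitAt (U ∷ʳ c) (3 + m) ≡ x
      bit-x = bit-< (ℕP.n<1+n (3 + m))

      bit-c : bitAt (U ∷ʳ c) (4 + m) ≡ c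
      bit-c = bitAt-∷ʳ-last U c

      3+m<5+m : 3 + m < 5 + m
      3+m<5+m = ℕP.m≤n⇒m≤1+n (ℕP.n<1+n (3 + m))

    CoverClosed-∷ʳ⁻ : CoverClosed (U ∷ʳ c) → CoverClosed U × respects (evenᵇ (5 + m)) x c ≡ true
    CoverClosed-∷ʳ⁻ closed = closedU , closed-at-end (evenᵇ (5 + m)) refl
      where
      closedU : CoverClosed U
      closedU a b cov a< b< a∈U = trans (sym (bit-< b<))
        (closed a b cov (ℕP.m≤n⇒m≤1+n a<) (ℕP.m≤n⇒m≤1+n b<) (trans (bit-< a<) a∈U))
      closed-at-end : ∀ up → evenᵇ (5 + m) ≡ up → respects up x c ≡ true
      closed-at-end true even = respects-up⁺ x c (λ x∈ → trans (sym bit-c)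
        (closed (3 + m) (4 + m) (Cov-up m even) 3+m<5+m (ℕP.n<1+n (4 + m)) (trans bit-x x∈)))
      closed-at-end false odd = respects-down⁺ x c (λ c∈ → trans (sym bit-x)
        (closed (4 + m) (3 + m) (Cov-down m odd) (ℕP.n<1+n (4 + m)) 3+m<5+m (trans bit-c c∈)))

    CoverClosed-∷ʳ⁺ : CoverClosed U → respects (evenᵇ (5 + m)) x c ≡ true → CoverClosed (U ∷ʳ c)
    CoverClosed-∷ʳ⁺ closed resp a b cov a< b< a∈ with ℕP.m<1+n⇒m<n∨m≡n b<
    ... | inj₂ refl with Cov-into-last (ℕP.≤-pred a<) cov
    ...   | even , refl = trans bit-c (respects-up⁻ (subst (λ up → respects up x c ≡ true) even resp) (trans (sym bit-x) a∈))
    CoverClosed-∷ʳ⁺ closed resp a b cov a< b< a∈ | inj₁ b<4+m with ℕP.m<1+n⇒m<n∨m≡n a<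
    ... | inj₂ refl with Cov-out-of-last (ℕP.<⇒≤ b<4+m) cov
    ...   | odd , refl = trans bit-x (respects-down⁻ (subst (λ up → respects up x c ≡ true) odd resp) (trans (sym bit-c) a∈))
    CoverClosed-∷ʳ⁺ closed resp a b cov a< b< a∈ | inj₁ b<4+m | inj₁ a<4+m =
      trans (bit-< b<4+m) (closed a b cov a<4+m b<4+m (trans (sym (bit-< a<4+m)) a∈))

  isFilter : ∀ {n} → Subset n → Bool
  isFilter S = does (IsFilter? S)

  private
    does-≡-∧ : ∀ {P Q : Set} (P? : Dec P) (Q? : Dec Q) (e : Bool) →
               (P → Q) → (P → e ≡ true) → (Q → e ≡ true → P) → does P? ≡ does Q? ∧ e
    does-≡-∧ (yes p) (yes q) true _ _ _ = refl
    does-≡-∧ (yes p) (yes q) false _ p⇒e _ with p⇒e p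
    ... | ()
    does-≡-∧ (yes p) (no ¬q) e p⇒q _ _ = ⊥-elim (¬q (p⇒q p))
    does-≡-∧ (no ¬p) (yes q) true _ _ q∧e⇒p = ⊥-elim (¬p (q∧e⇒p q refl))
    does-≡-∧ (no ¬p) (yes q) false _ _ _ = refl
    does-≡-∧ (no ¬p) (no ¬q) e _ _ _ = refl

  isFilter-∷ʳ : ∀ m (U : Vec Bool (4 + m)) c → isFilter (U ∷ʳ c) ≡ isFilter U ∧ respects (evenᵇ (5 + m)) (bitAt U (3 + m)) c
  isFilter-∷ʳ m U c = does-≡-∧ (IsFilter? (U ∷ʳ c)) (IsFilter? U) _
    (λ filter → CoverClosed⇒IsFilter U (proj₁ (CoverClosed-∷ʳ⁻ m U c (IsFilter⇒CoverClosed _ filter))))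
    (λ filter → proj₂ (CoverClosed-∷ʳ⁻ m U c (IsFilter⇒CoverClosed _ filter)))
    (λ filter resp → CoverClosed⇒IsFilter _ (CoverClosed-∷ʳ⁺ m U c (IsFilter⇒CoverClosed U filter) resp))

  deg : ∀ {n} → Subset n → ℕ
  deg {n} S = countSubsets n (λ T → isFilter T ∧ (hamming S T ≡ᵇ 1))

  degree≡deg : ∀ n S → degree n S ≡ deg S
  degree≡deg n S = trans (length-filter≡countᵇ _ (filters n)) (countᵇ-filter IsFilter? (λ T → does (hamming S T ℕP.≟ 1)) (subsets n))

  d≡countSubsets : ∀ n k → d n k ≡ countSubsets n (λ S → isFilter S ∧ (deg S ≡ᵇ k))
  d≡countSubsets n k = begin
    d n k                                                                    ≡⟨ length-filter≡countᵇ _ (filters n) ⟩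
    countᵇ (λ S → does (degree n S ℕP.≟ k)) (filters n)                       ≡⟨ countᵇ-filter IsFilter? _ (subsets n) ⟩
    countSubsets n (λ S → isFilter S ∧ does (degree n S ℕP.≟ k))               ≡⟨ countSubsets-cong n (λ S → cong (λ t → isFilter S ∧ (t ≡ᵇ k)) (degree≡deg n S)) ⟩
    countSubsets n (λ S → isFilter S ∧ (deg S ≡ᵇ k))                          ∎
    where open ≡-Reasoning

  Profile : Set
  Profile = Bool → Bool → ℕ → ℕ

  total : Profile → ℕ → ℕ
  total g k = (g true true k + g false true k) + (g true false k + g false false k)

  endCount : ℕ → Profile
  endCount m a b k = countSubsets m (λ S → isFilter (S ∷ʳ a ∷ʳ b) ∧ (deg (S ∷ʳ a ∷ʳ b) ≡ᵇ k))

  d≡total : ∀ m k → d (2 + m) k ≡ total (endCount m) k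
  d≡total m k = trans (d≡countSubsets (2 + m) k) (trans (countSubsets-∷ʳ (suc m) _ true)
                     (cong₂ _+_ (countSubsets-∷ʳ m _ true) (countSubsets-∷ʳ m _ true)))

  isFilter-∷ʳ∷ʳ : ∀ m (T : Vec Bool (3 + m)) b c → isFilter (T ∷ʳ b ∷ʳ c) ≡ isFilter (T ∷ʳ b) ∧ respects (evenᵇ (5 + m)) b c
  isFilter-∷ʳ∷ʳ m T b c = trans (isFilter-∷ʳ m (T ∷ʳ b) c) (cong (λ t → isFilter (T ∷ʳ b) ∧ respects (evenᵇ (5 + m)) t c) (bitAt-∷ʳ-last T b))

  -- The increase of the degree when a filter S a b is extended by c.
  jump : Bool → Bool → Bool → Bool → ℕ
  jump up a b c = boolToℕ (respects up a (not b) ∧ respects (not up) (not b) c) + boolToℕ (respects (not up) b (not c))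
                ∸ boolToℕ (respects up a (not b))

  private
    respects-not : ∀ up b c → respects up (not b) c ∨ respects up b (not c) ≡ true
    respects-not true true true = refl
    respects-not true true false = refl
    respects-not true false true = refl
    respects-not true false false = refl
    respects-not false true true = refl
    respects-not false true false = refl
    respects-not false false true = refl
    respects-not false false false = refl

    boolToℕ-≤ : ∀ p q r → q ∨ r ≡ true → boolToℕ p ≤ boolToℕ (p ∧ q) + boolToℕ r
    boolToℕ-≤ false q r _ = z≤n
    boolToℕ-≤ true true r _ = s≤s z≤n
    boolToℕ-≤ true false true _ = s≤s z≤n

    guarded-∧ : ∀ {new old e x y : Bool} → new ≡ old ∧ e → (e ≡ true → old ≡ true → x ≡ y) → new ∧ x ≡ e ∧ (old ∧ y)
    guarded-∧ {old = true} {true} refl x≡y = x≡y refl refl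
    guarded-∧ {old = false} {true} refl _ = refl
    guarded-∧ {old = true} {false} refl _ = refl
    guarded-∧ {old = false} {false} refl _ = refl

    ∧-true⁻ : ∀ {p q} → p ∧ q ≡ true → p ≡ true
    ∧-true⁻ {true} _ = refl

  jump-spec : ∀ up a b c → boolToℕ (respects up a (not b) ∧ respects (not up) (not b) c) + boolToℕ (respects (not up) b (not c))
                           ≡ boolToℕ (respects up a (not b)) + jump up a b c
  jump-spec up a b c = sym (ℕP.m+[n∸m]≡n (boolToℕ-≤ (respects up a (not b)) _ _ (respects-not (not up) b c)))

  deg-∷ʳ : ∀ m (S : Vec Bool (3 + m)) a b c → respects (not (evenᵇ (5 + m))) b c ≡ true → isFilter (S ∷ʳ a ∷ʳ b) ≡ true →
           deg (S ∷ʳ a ∷ʳ b ∷ʳ c) ≡ deg (S ∷ʳ a ∷ʳ b) + jump (evenᵇ (5 + m)) a b c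
  deg-∷ʳ m S a b c b→c Sab = begin
    deg (S ∷ʳ a ∷ʳ b ∷ʳ c)
      ≡⟨ countHamming1-∷ʳ (5 + m) isFilter (S ∷ʳ a ∷ʳ b) c ⟩
    countSubsets (5 + m) (λ T → isFilter (T ∷ʳ c) ∧ (hamming (S ∷ʳ a ∷ʳ b) T ≡ᵇ 1)) + ⟦ S ∷ʳ a ∷ʳ b ∷ʳ not c ⟧
      ≡⟨ cong (_+ ⟦ S ∷ʳ a ∷ʳ b ∷ʳ not c ⟧) (countHamming1-∷ʳ (4 + m) (λ T → isFilter (T ∷ʳ c)) (S ∷ʳ a) b) ⟩
    Q′ + ⟦ S ∷ʳ a ∷ʳ not b ∷ʳ c ⟧ + ⟦ S ∷ʳ a ∷ʳ b ∷ʳ not c ⟧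
      ≡⟨ cong₂ (λ x y → x + y + ⟦ S ∷ʳ a ∷ʳ b ∷ʳ not c ⟧) Q′≡Q (cong boolToℕ Sa¬bc) ⟩
    Q + boolToℕ (r₁ ∧ r₂) + ⟦ S ∷ʳ a ∷ʳ b ∷ʳ not c ⟧
      ≡⟨ cong (λ t → Q + boolToℕ (r₁ ∧ r₂) + boolToℕ t) (trans (isFilter-∷ʳ∷ʳ (suc m) (S ∷ʳ a) b (not c)) (cong (_∧ r₃) Sab)) ⟩
    Q + boolToℕ (r₁ ∧ r₂) + boolToℕ r₃
      ≡⟨ trans (ℕP.+-assoc Q _ _) (cong (Q +_) (jump-spec up a b c)) ⟩
    Q + (boolToℕ r₁ + jump up a b c)
      ≡⟨ sym (ℕP.+-assoc Q _ _) ⟩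
    Q + boolToℕ r₁ + jump up a b c
      ≡⟨ cong (λ t → Q + boolToℕ t + jump up a b c) (sym Sa¬b) ⟩
    Q + ⟦ S ∷ʳ a ∷ʳ not b ⟧ + jump up a b c
      ≡⟨ cong (_+ jump up a b c) (sym (countHamming1-∷ʳ (4 + m) isFilter (S ∷ʳ a) b)) ⟩
    deg (S ∷ʳ a ∷ʳ b) + jump up a b c ∎
    where
    open ≡-Reasoning
    up = evenᵇ (5 + m)
    ⟦_⟧ : ∀ {n} → Subset n → ℕ
    ⟦ T ⟧ = boolToℕ (isFilter T)
    r₁ = respects up a (not b)
    r₂ = respects (not up) (not b) c
    r₃ = respects (not up) b (not c)
    Q = countSubsets (4 + m) (λ T → isFilter (T ∷ʳ b) ∧ (hamming (S ∷ʳ a) T ≡ᵇ 1))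
    Q′ = countSubsets (4 + m) (λ T → isFilter (T ∷ʳ b ∷ʳ c) ∧ (hamming (S ∷ʳ a) T ≡ᵇ 1))
    Q′≡Q : Q′ ≡ Q
    Q′≡Q = countSubsets-cong (4 + m) (λ T → cong (_∧ (hamming (S ∷ʳ a) T ≡ᵇ 1))
             (trans (isFilter-∷ʳ∷ʳ (suc m) T b c) (trans (cong (isFilter (T ∷ʳ b) ∧_) b→c) (∧-identityʳ _))))
    Sa : isFilter (S ∷ʳ a) ≡ true
    Sa = ∧-true⁻ (trans (sym (isFilter-∷ʳ∷ʳ m S a b)) Sab)
    Sa¬b : isFilter (S ∷ʳ a ∷ʳ not b) ≡ r₁
    Sa¬b = trans (isFilter-∷ʳ∷ʳ m S a (not b)) (cong (_∧ r₁) Sa)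
    Sa¬bc : isFilter (S ∷ʳ a ∷ʳ not b ∷ʳ c) ≡ r₁ ∧ r₂
    Sa¬bc = trans (isFilter-∷ʳ∷ʳ (suc m) (S ∷ʳ a) (not b) c) (cong (_∧ r₂) Sa¬b)

  shiftBy : ℕ → (ℕ → ℕ) → ℕ → ℕ
  shiftBy zero f k = f k
  shiftBy (suc j) f zero = 0
  shiftBy (suc j) f (suc k) = shiftBy j f k

  countSubsets-shiftBy : ∀ n (P : Subset n → Bool) (f : Subset n → ℕ) j k →
    countSubsets n (λ S → P S ∧ (f S + j ≡ᵇ k)) ≡ shiftBy j (λ k → countSubsets n (λ S → P S ∧ (f S ≡ᵇ k))) k
  countSubsets-shiftBy n P f zero k = countSubsets-cong n (λ S → cong (λ t → P S ∧ (t ≡ᵇ k)) (ℕP.+-identityʳ (f S)))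
  countSubsets-shiftBy n P f (suc j) zero =
    countSubsets-false n (λ S → trans (cong (λ t → P S ∧ (t ≡ᵇ 0)) (ℕP.+-suc (f S) j)) (∧-zeroʳ (P S)))
  countSubsets-shiftBy n P f (suc j) (suc k) =
    trans (countSubsets-cong n (λ S → cong (λ t → P S ∧ (t ≡ᵇ suc k)) (ℕP.+-suc (f S) j))) (countSubsets-shiftBy n P f j k)

  step : Bool → Profile → Profile
  step up g b c k = if respects (not up) b c
                    then shiftBy (jump up true b c) (g true b) k + shiftBy (jump up false b c) (g false b) k
                    else 0

  endCount-step : ∀ m b c k → endCount (4 + m) b c k ≡ step (evenᵇ (5 + m)) (endCount (3 + m)) b c k
  endCount-step m b c k = trans (countSubsets-∷ʳ (3 + m) _ true) (trans (cong₂ _+_ (by-penultimate true) (by-penultimate false)) (if-+ (respects (not up) b c)))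
    where
    up = evenᵇ (5 + m)
    if-+ : ∀ e {x y} → (if e then x else 0) + (if e then y else 0) ≡ (if e then x + y else 0)
    if-+ true = refl
    if-+ false = refl
    filter-and-degree : ∀ S a → isFilter (S ∷ʳ a ∷ʳ b ∷ʳ c) ∧ (deg (S ∷ʳ a ∷ʳ b ∷ʳ c) ≡ᵇ k)
                                ≡ respects (not up) b c ∧ (isFilter (S ∷ʳ a ∷ʳ b) ∧ (deg (S ∷ʳ a ∷ʳ b) + jump up a b c ≡ᵇ k))
    filter-and-degree S a = guarded-∧ (isFilter-∷ʳ∷ʳ (suc m) (S ∷ʳ a) b c) (λ b→c Sab → cong (_≡ᵇ k) (deg-∷ʳ m S a b c b→c Sab))
    count-and : ∀ e (P : Subset (3 + m) → Bool) → countSubsets (3 + m) (λ S → e ∧ P S) ≡ (if e then countSubsets (3 + m) P else 0)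
    count-and true P = refl
    count-and false P = countSubsets-false (3 + m) (λ _ → refl)
    by-penultimate : ∀ a → countSubsets (3 + m) (λ S → isFilter (S ∷ʳ a ∷ʳ b ∷ʳ c) ∧ (deg (S ∷ʳ a ∷ʳ b ∷ʳ c) ≡ᵇ k))
                           ≡ (if respects (not up) b c then shiftBy (jump up a b c) (endCount (3 + m) a b) k else 0)
    by-penultimate a = trans (countSubsets-cong (3 + m) (λ S → filter-and-degree S a))
      (trans (count-and (respects (not up) b c) _)
        (cong (λ t → if respects (not up) b c then t else 0) (countSubsets-shiftBy (3 + m) _ (λ S → deg (S ∷ʳ a ∷ʳ b)) (jump up a b c) k)))

  private
    rearrange-up : ∀ x c d e f → x + c + 0 + (x + d + e) + f ≡ x + d + f + (x + c) + e
    rearrange-up = solve-∀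

    rearrange-down : ∀ e p q f → e + 0 + p + q + f ≡ f + 0 + p + q + e
    rearrange-down = solve-∀

  -- In each case both sides are the same sums of values of g, only grouped differently.
  total-step³ : ∀ g up k →
    total (step up (step (not up) (step up g))) k + shiftBy 2 (total g) k
    ≡ shiftBy 1 (total (step (not up) (step up g))) k + shiftBy 1 (total (step up g)) k + shiftBy 1 (total g) k
  total-step³ g true zero = refl
  total-step³ g true (suc zero) =
    rearrange-up (0 + g false true 0 + 0) (0 + 0 + (g true false 0 + g false false 0)) 0 (total g 0) 0
  total-step³ g true (suc (suc zero)) =
    rearrange-up (g true true 0 + g false true 1 + 0) (g true true 0 + g false true 0 + (g true false 1 + g false false 1))
                 (0 + 0 + (g true false 0 + g false false 0)) (total g 1) (total g 0)
  total-step³ g true (suc (suc (suc k))) =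
    rearrange-up (g true true (1 + k) + g false true (2 + k) + 0)
                 (g true true (1 + k) + g false true (1 + k) + (g true false (2 + k) + g false false (2 + k)))
                 (g true true k + g false true k + (g true false (1 + k) + g false false (1 + k))) (total g (2 + k)) (total g (1 + k))
  total-step³ g false zero = refl
  total-step³ g false (suc zero) =
    rearrange-down (total g 0) (0 + 0 + (0 + 0) + (g true false 0 + 0)) (g true true 0 + g false true 0 + (0 + 0) + (g true false 0 + 0)) 0
  total-step³ g false (suc (suc zero)) =
    rearrange-down (total g 1) (g true true 0 + g false true 0 + (0 + 0) + (g true false 1 + g false false 0))
                   (g true true 1 + g false true 1 + (g true false 0 + g false false 0) + (g true false 1 + g false false 0)) (total g 0)
  total-step³ g false (suc (suc (suc k))) =
    rearrange-down (total g (2 + k))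
                   (g true true (1 + k) + g false true (1 + k) + (g true false k + g false false k) + (g true false (2 + k) + g false false (1 + k)))
                   (g true true (2 + k) + g false true (2 + k) + (g true false (1 + k) + g false false (1 + k)) + (g true false (2 + k) + g false false (1 + k)))
                   (total g (1 + k))

  _≐_ : Profile → Profile → Set
  g ≐ h = ∀ a b k → g a b k ≡ h a b k

  shiftBy-cong : ∀ j {f f′ : ℕ → ℕ} → (∀ k → f k ≡ f′ k) → ∀ k → shiftBy j f k ≡ shiftBy j f′ k
  shiftBy-cong zero f≗f′ k = f≗f′ k
  shiftBy-cong (suc j) f≗f′ zero = refl
  shiftBy-cong (suc j) f≗f′ (suc k) = shiftBy-cong j f≗f′ k

  step-cong : ∀ up {g h} → g ≐ h → step up g ≐ step up h
  step-cong up g≐h b c k = cong (λ t → if respects (not up) b c then t else 0)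
    (cong₂ _+_ (shiftBy-cong (jump up true b c) (g≐h true b) k) (shiftBy-cong (jump up false b c) (g≐h false b) k))

  total-cong : ∀ {g h} → g ≐ h → ∀ k → total g k ≡ total h k
  total-cong g≐h k = cong₂ _+_ (cong₂ _+_ (g≐h true true k) (g≐h false true k)) (cong₂ _+_ (g≐h true false k) (g≐h false false k))

  d-recurrence : ∀ m k → d (8 + m) k + shiftBy 2 (d (5 + m)) k ≡ shiftBy 1 (d (7 + m)) k + shiftBy 1 (d (6 + m)) k + shiftBy 1 (d (5 + m)) k
  d-recurrence m k = begin
    d (8 + m) k + shiftBy 2 (d (5 + m)) k
      ≡⟨ cong₂ _+_ (trans (d≡total (6 + m) k) (total-cong E₃≐ k)) (shiftBy-cong 2 (d≡total (3 + m)) k) ⟩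
    total (step up (step (not up) (step up E₀))) k + shiftBy 2 (total E₀) k
      ≡⟨ total-step³ E₀ up k ⟩
    shiftBy 1 (total (step (not up) (step up E₀))) k + shiftBy 1 (total (step up E₀)) k + shiftBy 1 (total E₀) k
      ≡⟨ sym (cong₂ _+_ (cong₂ _+_ (shiftBy-cong 1 (λ k → trans (d≡total (5 + m) k) (total-cong E₂≐ k)) k)
                                   (shiftBy-cong 1 (λ k → trans (d≡total (4 + m) k) (total-cong E₁≐ k)) k))
                        (shiftBy-cong 1 (d≡total (3 + m)) k)) ⟩
    shiftBy 1 (d (7 + m)) k + shiftBy 1 (d (6 + m)) k + shiftBy 1 (d (5 + m)) k ∎
    where
    open ≡-Reasoning
    up = evenᵇ (5 + m)
    E₀ = endCount (3 + m)
    E₁≐ : endCount (4 + m) ≐ step up E₀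
    E₁≐ = endCount-step m
    E₂≐ : endCount (5 + m) ≐ step (not up) (step up E₀)
    E₂≐ b c k = trans (endCount-step (1 + m) b c k) (step-cong (not up) E₁≐ b c k)
    E₃≐ : endCount (6 + m) ≐ step up (step (not up) (step up E₀))
    E₃≐ b c k = trans (endCount-step (2 + m) b c k)
      (trans (step-cong (not (not up)) E₂≐ b c k) (cong (λ u → step u (step (not up) (step up E₀)) b c k) (not-involutive up)))

open import Data.Nat as ℕ using (ℕ; zero; suc; _≤_; s≤s)
open import Data.Integer using (ℤ; +_; _+_; _-_)
open import Data.Integer.Tactic.RingSolver using (solve-∀)
open import Data.Product using (_×_; _,_; proj₁)
open import Relation.Binary.PropositionalEquality
open BinomialSums using (shift; rhs-recurrence; rhs-beyond)
open FilterDegrees using (_≐_; shiftBy; d-recurrence; evenᵇ; step; endCount; endCount-step; total; total-cong; step-cong; d≡total)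

shift-+ : ∀ (f : ℕ → ℕ) k → + shiftBy 1 f k ≡ shift (λ k → + f k) k
shift-+ f zero = refl
shift-+ f (suc k) = refl

shift²-+ : ∀ (f : ℕ → ℕ) k → + shiftBy 2 f k ≡ shift (shift (λ k → + f k)) k
shift²-+ f zero = refl
shift²-+ f (suc zero) = refl
shift²-+ f (suc (suc k)) = refl

shift-cong : ∀ {f g : ℕ → ℤ} → (∀ k → f k ≡ g k) → ∀ k → shift f k ≡ shift g k
shift-cong f≗g zero = refl
shift-cong f≗g (suc k) = f≗g k

Agrees : ℕ → Set
Agrees n = ∀ k → + d n k ≡ rhs n k

agrees-step : ∀ m → Agrees (5 ℕ.+ m) → Agrees (6 ℕ.+ m) → Agrees (7 ℕ.+ m) → Agrees (8 ℕ.+ m)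
agrees-step m agrees₅ agrees₆ agrees₇ k = begin
  + d (8 ℕ.+ m) k
    ≡⟨ isolate (+ d (8 ℕ.+ m) k) (+ shiftBy 2 (d (5 ℕ.+ m)) k) (cong +_ (d-recurrence m k)) ⟩
  + shiftBy 1 (d (7 ℕ.+ m)) k + + shiftBy 1 (d (6 ℕ.+ m)) k + + shiftBy 1 (d (5 ℕ.+ m)) k - + shiftBy 2 (d (5 ℕ.+ m)) k
    ≡⟨ cong₂ _-_ (cong₂ _+_ (cong₂ _+_ (to-rhs agrees₇) (to-rhs agrees₆)) (to-rhs agrees₅))
                 (trans (shift²-+ (d (5 ℕ.+ m)) k) (shift-cong (shift-cong agrees₅) k)) ⟩
  shift (rhs (7 ℕ.+ m)) k + shift (rhs (6 ℕ.+ m)) k + shift (rhs (5 ℕ.+ m)) k - shift (shift (rhs (5 ℕ.+ m))) k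
    ≡⟨ sym (rhs-recurrence (5 ℕ.+ m) k) ⟩
  rhs (8 ℕ.+ m) k ∎
  where
  open ≡-Reasoning
  isolate : ∀ a s {t} → a + s ≡ t → a ≡ t - s
  isolate a s refl = cancel a s
    where cancel : ∀ a s → a ≡ a + s - s
          cancel = solve-∀
  to-rhs : ∀ {n} → Agrees n → + shiftBy 1 (d n) k ≡ shift (rhs n) k
  to-rhs {n} agrees = trans (shift-+ (d n) k) (shift-cong agrees k)

agrees-3 : Agrees 3
agrees-3 0 = refl
agrees-3 1 = refl
agrees-3 2 = refl
agrees-3 3 = refl
agrees-3 (suc (suc (suc (suc e)))) = sym (rhs-beyond 3 e)

agrees-4 : Agrees 4
agrees-4 0 = refl
agrees-4 1 = refl
agrees-4 2 = refl
agrees-4 3 = refl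
agrees-4 4 = refl
agrees-4 (suc (suc (suc (suc (suc e))))) = sym (rhs-beyond 4 e)

agrees-5 : Agrees 5
agrees-5 0 = refl
agrees-5 1 = refl
agrees-5 2 = refl
agrees-5 3 = refl
agrees-5 4 = refl
agrees-5 5 = refl
agrees-5 (suc (suc (suc (suc (suc (suc e)))))) = sym (rhs-beyond 5 e)

-- For 6 and 7 elements one or two transfer steps from the filters of φ₅ keep the evaluation small.
agrees-6 : Agrees 6
agrees-6 k = trans (cong +_ (trans (d≡total 4 k) (total-cong (endCount-step 0) k))) (evaluate k)
  where
  evaluate : ∀ k → + total (step (evenᵇ 5) (endCount 3)) k ≡ rhs 6 k
  evaluate 0 = refl
  evaluate 1 = refl
  evaluate 2 = refl
  evaluate 3 = refl
  evaluate 4 = refl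
  evaluate 5 = refl
  evaluate 6 = refl
  evaluate (suc (suc (suc (suc (suc (suc (suc e))))))) = sym (rhs-beyond 6 e)

agrees-7 : Agrees 7
agrees-7 k = trans (cong +_ (trans (d≡total 5 k) (total-cong two-steps k))) (evaluate k)
  where
  two-steps : endCount 5 ≐ step (evenᵇ 6) (step (evenᵇ 5) (endCount 3))
  two-steps b c k = trans (endCount-step 1 b c k) (step-cong (evenᵇ 6) (endCount-step 0) b c k)
  evaluate : ∀ k → + total (step (evenᵇ 6) (step (evenᵇ 5) (endCount 3))) k ≡ rhs 7 k
  evaluate 0 = refl
  evaluate 1 = refl
  evaluate 2 = refl
  evaluate 3 = refl
  evaluate 4 = refl
  evaluate 5 = refl
  evaluate 6 = refl
  evaluate 7 = refl
  evaluate (suc (suc (suc (suc (suc (suc (suc (suc e)))))))) = sym (rhs-beyond 7 e)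

agrees-from-5 : ∀ m → Agrees (5 ℕ.+ m) × Agrees (6 ℕ.+ m) × Agrees (7 ℕ.+ m)
agrees-from-5 zero = agrees-5 , agrees-6 , agrees-7
agrees-from-5 (suc m) =
  let (agrees₅ , agrees₆ , agrees₇) = agrees-from-5 m in agrees₆ , agrees₇ , agrees-step m agrees₅ agrees₆ agrees₇

proposition11 : ∀ (n k : ℕ) → 3 ≤ n → + (d n k) ≡ rhs n k
proposition11 1 k (s≤s ())
proposition11 2 k (s≤s (s≤s ()))
proposition11 3 k _ = agrees-3 k
proposition11 4 k _ = agrees-4 k
proposition11 (suc (suc (suc (suc (suc m))))) k _ = proj₁ (agrees-from-5 m) k
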